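{- Let $\theta_1$ and $\theta_2$ be substitutions that are arity type compatible relative to an arity context $\Theta$, and let $\Theta'=\mathrm{ctx}(\theta_2\circ\theta_1)\oplus\Theta$. (1) If $E$ is a canonical kind, type or context that respects $\Theta'$ and $E',E''$ are such that $[\theta_1]E=E'$ and $[\theta_2]E'=E''$ are derivable, then $[\theta_2\circ\theta_1]E=E''$ is derivable. (2) If $M$ is a canonical term such that $\Theta'\vdash M:\alpha$ is derivable for some arity type $\alpha$, and $M',M''$ are canonical terms such that $[\theta_1]M=M'$ and $[\theta_2]M'=M''$ are derivable, then $[\theta_2\circ\theta_1]M=M''$ is derivable. (3) If $R$ is an atomic term such that $\Theta'\vdash R\Rightarrow\alpha$ is derivable for some arity type $\alpha$, then: (a) if $M',M''$ are canonical terms such that $[\theta_1]_rR=M':\alpha$ and $[\theta_2]M'=M''$ are derivable, then $[\theta_2\circ\theta_1]_rR=M'':\alpha$ is derivable; (b) if $R'$ is atomic and $M''$ canonical such that $[\theta_1]_rR=R'$ and $[\theta_2]_rR'=M'':\alpha$ are derivable, then $[\theta_2\circ\theta_1]_rR=M'':\alpha$ is derivable; (c) if $R',R''$ are atomic terms such that $[\theta_1]_rR=R'$ and $[\theta_2]_rR'=R''$ are derivable, then $[\theta_2\circ\theta_1]_rR=R''$ is derivable.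
   Context: Canonical LF syntax: kinds $K ::= \mathrm{Type} \mid \Pi x{:}A.K$; canonical types $A ::= P \mid \Pi x{:}A.B$; atomic types $P ::= a \mid P\,M$; canonical terms $M ::= R \mid \lambda x.M$; atomic terms $R ::= c \mid x \mid R\,M$; contexts $\Gamma ::= \cdot\mid\Gamma,x{:}A$ (up to renaming of bound variables). Arity types are generated from $o$ by $\rightarrow$; erasure: $P^-=o$, $(\Pi x{:}A_1.A_2)^-=A_1^-\rightarrow A_2^-$. A substitution is a finite set of triples $\langle x,M,\alpha\rangle$ with distinct variables $x$, canonical $M$, arity type $\alpha$; $\mathrm{ctx}(\theta)=\{x:\alpha\mid\langle x,M,\alpha\rangle\in\theta\}$. Arity contexts $\Theta$: sets of unique assignments of arity types to constants and variables; $\Theta_1\oplus\Theta_2$ is $\Theta_1$ together with the assignments of $\Theta_2$ to symbols not assigned in $\Theta_1$. Arity typing: $\Theta\vdash c\Rightarrow\alpha$ / $\Theta\vdash x\Rightarrow\alpha$ if the symbol is assigned $\alpha$; $\Theta\vdash R\,M\Rightarrow\alpha$ if $\Theta\vdash R\Rightarrow\alpha'\rightarrow\alpha$ and $\Theta\vdash M:\alpha'$; $\Theta\vdash\lambda x.M:\alpha_1\rightarrow\alpha_2$ if $\{x:\alpha_1\}\oplus\Theta\vdash M:\alpha_2$; $\Theta\vdash R:o$ if $\Theta\vdash R\Rightarrow o$. A kind or type respects $\Theta$ if it is $\mathrm{Type}$, or it is atomic and every canonical term in it has some arity type under $\Theta$, or it is $\Pi x{:}A.E'$ with $A$ respecting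 $\Theta$ and $E'$ respecting $\{x:A^-\}\oplus\Theta$; a context respects $\Theta$ if each type in it does. $\theta$ is arity type preserving w.r.t. $\Theta$ if $\Theta\vdash M:\alpha$ for every $\langle x,M,\alpha\rangle\in\theta$. $\theta_1,\theta_2$ are arity type compatible relative to $\Theta$ if $\theta_2$ is arity type preserving w.r.t. $\Theta$ and $\theta_1$ is arity type preserving w.r.t. $\mathrm{ctx}(\theta_2)\oplus\Theta$. Their composition is $\theta_2\circ\theta_1=\{\langle x,M',\alpha\rangle\mid\langle x,M,\alpha\rangle\in\theta_1,\ [\theta_2]M=M'\}\cup\{\langle y,N,\beta\rangle\in\theta_2\mid y\notin\mathrm{dom}(\theta_1)\}$ (well defined: such $M'$ exists and is unique). Hereditary substitution is the least relation closed under: $[\theta]R=R'$ if $[\theta]_rR=R'$; $[\theta]R=M'$ if $[\theta]_rR=M':\alpha'$; $[\theta](\lambda x.M)=\lambda x.M'$ if $x\notin\mathrm{dom}(\theta)$, $x$ not free in $\mathrm{rng}(\theta)$, $[\theta]M=M'$; $[\theta]_rx=M:\alpha$ if $\langle x,M,\alpha\rangle\in\theta$; $[\theta]_r(R\,M)=M''':\alpha''$ if $[\theta]_rR=\lambda x.M':\alpha'\rightarrow\alpha''$, $[\theta]M=M''$, $[\{\langle x,M'',\alpha'\rangle\}]M'=M'''$; $[\theta]_rc=c$; $[\theta]_rx=x$ if $x\notin\mathrm{dom}(\theta)$; $[\theta]_r(R\,M)=R'\,M'$ if $[\theta]_rR=R'$, $[\theta]M=M'$; for types $[\theta]a=a$,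 $[\theta](P\,M)=P'\,M'$, and $[\theta](\Pi x{:}A_1.A_2)=\Pi x{:}A_1'.A_2'$ componentwise with $x$ fresh for $\theta$; for kinds analogously with $[\theta]\mathrm{Type}=\mathrm{Type}$; for contexts $[\theta]\cdot=\cdot$ and $[\theta](\Gamma,x{:}A)=\Gamma',x{:}A'$ if $x$ fresh for $\theta$, $[\theta]\Gamma=\Gamma'$, $[\theta]A=A'$. -}

module Defs where

-- Canonical LF (Southern–Nadathur style) in a LOCALLY NAMELESS encoding:
-- free variables are names (ℕ), bound variables are de Bruijn indices,
-- so syntactic equality is equality "up to renaming of bound variables".
-- Binders are handled by opening with a fresh name; "for a fresh x" is
-- rendered by cofinite quantification (for all x outside some finite list L).

open import Data.Nat using (ℕ; zero; suc; _≡ᵇ_)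
open import Data.Bool using (Bool; true; false; if_then_else_)
open import Data.Maybe using (Maybe; just; nothing)
open import Data.Product using (Σ; ∃; _×_; _,_; proj₁; proj₂)
open import Data.Sum using (_⊎_)
open import Data.List using (List; []; _∷_; _++_; map; concatMap)
open import Data.List.Membership.Propositional using (_∈_; _∉_)
open import Data.List.Relation.Unary.All using (All)
open import Data.List.Relation.Unary.Unique.Propositional using (Unique)
open import Relation.Binary.PropositionalEquality using (_≡_)
open import Function.Bundles using (_⇔_)

Var : Set
Var = ℕ

Const : Set
Const = ℕ

mutual
  data Can : Set where
    atm : Atm → Can
    lam : Can → Can

  data Atm : Set where
    con  : Const → Atm
    fvar : Var → Atm
    bvar : ℕ → Atm
    app  : Atm → Can → Atm

data ATy : Set where
  tcon : Const → ATy
  tapp : ATy → Can → ATy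

data Ty : Set where
  base : ATy → Ty
  pi   : Ty → Ty → Ty          -- second component binds index 0

data Kind : Set where
  type : Kind
  kpi  : Ty → Kind → Kind

data Ctx : Set where
  ·     : Ctx
  _,,_∶_ : Ctx → Var → Ty → Ctx

mutual
  openC : ℕ → Var → Can → Can
  openC k x (atm R) = atm (openR k x R)
  openC k x (lam M) = lam (openC (suc k) x M)

  openR : ℕ → Var → Atm → Atm
  openR k x (con c)   = con c
  openR k x (fvar y)  = fvar y
  openR k x (bvar i)  = if i ≡ᵇ k then fvar x else bvar i
  openR k x (app R M) = app (openR k x R) (openC k x M)

openP : ℕ → Var → ATy → ATy
openP k x (tcon a)   = tcon a
openP k x (tapp P M) = tapp (openP k x P) (openC k x M)

openT : ℕ → Var → Ty → Ty
openT k x (base P)  = base (openP k x P)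
openT k x (pi A B)  = pi (openT k x A) (openT (suc k) x B)

openK : ℕ → Var → Kind → Kind
openK k x type      = type
openK k x (kpi A K) = kpi (openT k x A) (openK (suc k) x K)

mutual
  fvC : Can → List Var
  fvC (atm R) = fvR R
  fvC (lam M) = fvC M

  fvR : Atm → List Var
  fvR (con c)   = []
  fvR (fvar y)  = y ∷ []
  fvR (bvar i)  = []
  fvR (app R M) = fvR R ++ fvC M

termsP : ATy → List Can
termsP (tcon a)   = []
termsP (tapp P M) = termsP P ++ (M ∷ [])

infixr 5 _⇒_
data Arity : Set where
  o   : Arity
  _⇒_ : Arity → Arity → Arity

_⁻ : Ty → Arity
base P ⁻ = o
pi A B ⁻ = (A ⁻) ⇒ (B ⁻)

-- Arity contexts: unique assignments of arity types to constants and
-- variables, represented as partial maps.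

data Sym : Set where
  scon : Const → Sym
  svar : Var → Sym

ArCtx : Set
ArCtx = Sym → Maybe Arity

_⊕_ : ArCtx → ArCtx → ArCtx
(Θ₁ ⊕ Θ₂) s with Θ₁ s
... | just α  = just α
... | nothing = Θ₂ s

⟨_∶_⟩ : Var → Arity → ArCtx
⟨ x ∶ α ⟩ (scon c) = nothing
⟨ x ∶ α ⟩ (svar y) = if y ≡ᵇ x then just α else nothing

Triple : Set
Triple = Var × Can × Arity

record Subst : Set where
  constructor mkSubst
  field
    triples  : List Triple
    distinct : Unique (map proj₁ triples)
open Subst public

_∈ₛ_ : Triple → Subst → Set
t ∈ₛ θ = t ∈ triples θ

dom : Subst → List Var
dom θ = map proj₁ (triples θ)

fvRng : Subst → List Var
fvRng θ = concatMap (λ t → fvC (proj₁ (proj₂ t))) (triples θ)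

singleton : Var → Can → Arity → Subst
singleton x M α = mkSubst ((x , M , α) ∷ []) (AllP._∷_ All.[] AllP.[])
  where
  import Data.List.Relation.Unary.All as All
  import Data.List.Relation.Unary.AllPairs as AllP

lookupVar : List Triple → Var → Maybe Arity
lookupVar [] x = nothing
lookupVar ((y , M , α) ∷ ts) x = if y ≡ᵇ x then just α else lookupVar ts x

ctx : Subst → ArCtx
ctx θ (scon c) = nothing
ctx θ (svar x) = lookupVar (triples θ) x

mutual
  data _⊢_⇒_ (Θ : ArCtx) : Atm → Arity → Set where
    ar-con : ∀ {c α} → Θ (scon c) ≡ just α → Θ ⊢ con c ⇒ α
    ar-var : ∀ {x α} → Θ (svar x) ≡ just α → Θ ⊢ fvar x ⇒ α
    ar-app : ∀ {R M α α′} → Θ ⊢ R ⇒ (α′ ⇒ α) → Θ ⊢ M ∶ α′ → Θ ⊢ app R M ⇒ α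

  data _⊢_∶_ (Θ : ArCtx) : Can → Arity → Set where
    ar-lam : ∀ {M α₁ α₂} (L : List Var) →
             (∀ x → x ∉ L → (⟨ x ∶ α₁ ⟩ ⊕ Θ) ⊢ openC 0 x M ∶ α₂) →
             Θ ⊢ lam M ∶ (α₁ ⇒ α₂)
    ar-atm : ∀ {R} → Θ ⊢ R ⇒ o → Θ ⊢ atm R ∶ o

RespectsP : ArCtx → ATy → Set
RespectsP Θ P = All (λ M → ∃ λ α → Θ ⊢ M ∶ α) (termsP P)

data RespectsT : ArCtx → Ty → Set where
  rs-base : ∀ {Θ P} → RespectsP Θ P → RespectsT Θ (base P)
  rs-pi   : ∀ {Θ A B} (L : List Var) → RespectsT Θ A →
            (∀ x → x ∉ L → RespectsT (⟨ x ∶ A ⁻ ⟩ ⊕ Θ) (openT 0 x B)) →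
            RespectsT Θ (pi A B)

data RespectsK : ArCtx → Kind → Set where
  rs-type : ∀ {Θ} → RespectsK Θ type
  rs-kpi  : ∀ {Θ A K} (L : List Var) → RespectsT Θ A →
            (∀ x → x ∉ L → RespectsK (⟨ x ∶ A ⁻ ⟩ ⊕ Θ) (openK 0 x K)) →
            RespectsK Θ (kpi A K)

data RespectsCtx (Θ : ArCtx) : Ctx → Set where
  rs-nil  : RespectsCtx Θ ·
  rs-cons : ∀ {Γ x A} → RespectsCtx Θ Γ → RespectsT Θ A → RespectsCtx Θ (Γ ,, x ∶ A)

ArityPreserving : ArCtx → Subst → Set
ArityPreserving Θ θ = All (λ t → Θ ⊢ proj₁ (proj₂ t) ∶ proj₂ (proj₂ t)) (triples θ)

Compatible : Subst → Subst → ArCtx → Set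
Compatible θ₁ θ₂ Θ = ArityPreserving Θ θ₂ × ArityPreserving (ctx θ₂ ⊕ Θ) θ₁

mutual
  data SubC : Subst → Can → Can → Set where
    hs-atm   : ∀ {θ R R′} → SubR θ R R′ → SubC θ (atm R) (atm R′)
    hs-atmrc : ∀ {θ R M′ α′} → SubRC θ R M′ α′ → SubC θ (atm R) M′
    hs-lam   : ∀ {θ M M′} (L : List Var) →
               (∀ x → x ∉ L → x ∉ dom θ → x ∉ fvRng θ →
                 SubC θ (openC 0 x M) (openC 0 x M′)) →
               SubC θ (lam M) (lam M′)

  data SubRC : Subst → Atm → Can → Arity → Set where
    hs-var : ∀ {θ x M α} → (x , M , α) ∈ₛ θ → SubRC θ (fvar x) M α
    hs-app : ∀ {θ R M N M″ M‴ α′ α″} (L : List Var) →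
             SubRC θ R (lam N) (α′ ⇒ α″) →
             SubC θ M M″ →
             (∀ x → x ∉ L → SubC (singleton x M″ α′) (openC 0 x N) M‴) →
             SubRC θ (app R M) M‴ α″

  data SubR : Subst → Atm → Atm → Set where
    hs-con  : ∀ {θ c} → SubR θ (con c) (con c)
    hs-fvar : ∀ {θ x} → x ∉ dom θ → SubR θ (fvar x) (fvar x)
    hs-app  : ∀ {θ R R′ M M′} → SubR θ R R′ → SubC θ M M′ → SubR θ (app R M) (app R′ M′)

data SubP (θ : Subst) : ATy → ATy → Set where
  hs-tcon : ∀ {a} → SubP θ (tcon a) (tcon a)
  hs-tapp : ∀ {P P′ M M′} → SubP θ P P′ → SubC θ M M′ → SubP θ (tapp P M) (tapp P′ M′)

data SubT (θ : Subst) : Ty → Ty → Set where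
  hs-base : ∀ {P P′} → SubP θ P P′ → SubT θ (base P) (base P′)
  hs-pi   : ∀ {A₁ A₁′ A₂ A₂′} (L : List Var) → SubT θ A₁ A₁′ →
            (∀ x → x ∉ L → x ∉ dom θ → x ∉ fvRng θ →
              SubT θ (openT 0 x A₂) (openT 0 x A₂′)) →
            SubT θ (pi A₁ A₂) (pi A₁′ A₂′)

data SubK (θ : Subst) : Kind → Kind → Set where
  hs-type : SubK θ type type
  hs-kpi  : ∀ {A A′ K K′} (L : List Var) → SubT θ A A′ →
            (∀ x → x ∉ L → x ∉ dom θ → x ∉ fvRng θ →
              SubK θ (openK 0 x K) (openK 0 x K′)) →
            SubK θ (kpi A K) (kpi A′ K′)

data SubCtx (θ : Subst) : Ctx → Ctx → Set where
  hs-nil  : SubCtx θ · ·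
  hs-cons : ∀ {Γ Γ′ x A A′} → x ∉ dom θ → x ∉ fvRng θ →
            SubCtx θ Γ Γ′ → SubT θ A A′ → SubCtx θ (Γ ,, x ∶ A) (Γ′ ,, x ∶ A′)

IsComposition : Subst → Subst → Subst → Set
IsComposition θ₂ θ₁ θ =
  ∀ x M′ α → ((x , M′ , α) ∈ₛ θ) ⇔
    ((∃ λ M → ((x , M , α) ∈ₛ θ₁) × SubC θ₂ M M′)
     ⊎ (((x , M′ , α) ∈ₛ θ₂) × x ∉ dom θ₁))

{-# OPTIONS --safe #-}
module Submission where

-- Hereditary substitution is total and functional on arity-typed terms, which lets the two sides
-- of each claim be compared. The composition property is proved for all pairs of substitutions
-- that are well typed in sequence, by induction on the total size of the arity types they carry
-- and, inside that, on the typing derivation. The one non-structural case is a redex created by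
-- θ₁, where [θ₂]([x ↦ M]N) must equal [x ↦ [θ₂]M]([θ₂]N): both are computed by the composite
-- θ₂ ∪ [x ↦ [θ₂]M], using the induction hypothesis for the pairs ([x ↦ M], θ₂) and
-- (θ₂, [x ↦ [θ₂]M]), which are smaller because the arity of x is a proper part of the arity of
-- the head that θ₁ replaced. Kinds, types and contexts then follow componentwise.

open import Defs
open import Data.Bool using (true; false; if_then_else_; T)
open import Data.Empty using (⊥; ⊥-elim)
open import Data.List using (List; []; _∷_; _++_; map; foldr)
open import Data.List.Membership.Propositional using (_∈_; _∉_; lose; find)
open import Data.List.Membership.Propositional.Properties
  using (∈-++⁺ˡ; ∈-++⁺ʳ; ∈-++⁻; ∈-map⁺; ∈-map⁻; ∈-concatMap⁺; ∈-concatMap⁻)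
open import Data.List.Properties using (map-∘; map-id-local; ++-identityʳ)
open import Data.List.Relation.Unary.Any using (here; there)
open import Data.List.Relation.Unary.All as All using (All; []; _∷_)
open import Data.List.Relation.Unary.All.Properties using (¬Any⇒All¬) renaming (++⁻ to All-++⁻)
open import Data.List.Relation.Unary.AllPairs using (_∷_)
open import Data.List.Relation.Unary.Unique.Propositional using (Unique)
open import Data.Maybe using (just; nothing)
open import Data.Maybe.Properties using (just-injective)
open import Data.Nat using (ℕ; zero; suc; _≡ᵇ_; _+_; _≤_; _<_; s≤s; _⊔_)
open import Data.Nat.Induction using (<-rec)
open import Data.Nat.Properties
  using (≡ᵇ⇒≡; _≟_; m≤m⊔n; m≤n⊔m; ≤-trans; ≤-refl; ≤-reflexive; 1+n≰n; n<1+n; m≤n⇒m≤1+n; <⇒≢;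
         m≤m+n; m≤n+m; +-comm; +-identityʳ; +-monoˡ-<; <-≤-trans)
open import Data.List.Membership.DecPropositional _≟_ using (_∈?_)
open import Data.Product using (_×_; ∃; _,_; proj₁; proj₂; uncurry)
import Data.Product as Product
open import Data.Sum using (_⊎_; inj₁; inj₂; [_,_])
import Data.Sum as Sum
open import Data.Unit using (⊤; tt)
open import Function using (_∘_)
open import Function.Bundles using (mk⇔; Equivalence)
open import Relation.Binary.PropositionalEquality hiding ([_])
open import Relation.Nullary using (yes; no)

≡ᵇ-refl : ∀ x → (x ≡ᵇ x) ≡ true
≡ᵇ-refl zero    = refl
≡ᵇ-refl (suc x) = ≡ᵇ-refl x

≢⇒≡ᵇ-false : ∀ {x y} → x ≢ y → (x ≡ᵇ y) ≡ false
≢⇒≡ᵇ-false {x} {y} x≢y with x ≡ᵇ y in eq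
... | false = refl
... | true  = ⊥-elim (x≢y (≡ᵇ⇒≡ x y (subst T (sym eq) tt)))

maximum : List ℕ → ℕ
maximum = foldr _⊔_ 0

∈⇒≤maximum : ∀ {x xs} → x ∈ xs → x ≤ maximum xs
∈⇒≤maximum {xs = y ∷ xs} (here refl) = m≤m⊔n y (maximum xs)
∈⇒≤maximum {xs = y ∷ xs} (there x∈) = ≤-trans (∈⇒≤maximum x∈) (m≤n⊔m y (maximum xs))

fresh : (L : List Var) → ∃ λ x → x ∉ L
fresh L = suc (maximum L) , λ x∈L → 1+n≰n (∈⇒≤maximum x∈L)

∉-++⁻ : ∀ {x : Var} xs {ys} → x ∉ xs ++ ys → x ∉ xs × x ∉ ys
∉-++⁻ xs x∉ = x∉ ∘ ∈-++⁺ˡ , x∉ ∘ ∈-++⁺ʳ xs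

∉-∷⁻ : ∀ {x y : Var} {ys} → x ∉ y ∷ ys → x ≢ y × x ∉ ys
∉-∷⁻ x∉ = x∉ ∘ here , x∉ ∘ there

⊕-just : ∀ {Θ₁ Θ₂ : ArCtx} s {α} → Θ₁ s ≡ just α → (Θ₁ ⊕ Θ₂) s ≡ just α
⊕-just {Θ₁} s eq with Θ₁ s | eq
... | just _ | refl = refl

⊕-nothing : ∀ {Θ₁ Θ₂ : ArCtx} s → Θ₁ s ≡ nothing → (Θ₁ ⊕ Θ₂) s ≡ Θ₂ s
⊕-nothing {Θ₁} s eq with Θ₁ s | eq
... | nothing | refl = refl

⊕-congˡ : ∀ {Θ₁ Θ₂ Θ₃ : ArCtx} s → Θ₂ s ≡ Θ₃ s → (Θ₁ ⊕ Θ₂) s ≡ (Θ₁ ⊕ Θ₃) s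
⊕-congˡ {Θ₁} s eq with Θ₁ s
... | just _  = refl
... | nothing = eq

⟨⟩⊕-here : ∀ {Θ : ArCtx} x α → (⟨ x ∶ α ⟩ ⊕ Θ) (svar x) ≡ just α
⟨⟩⊕-here {Θ} x α = ⊕-just {⟨ x ∶ α ⟩} {Θ} (svar x) (cong (if_then just α else nothing) (≡ᵇ-refl x))

⟨⟩⊕-there : ∀ {Θ : ArCtx} {x y} α → y ≢ x → (⟨ x ∶ α ⟩ ⊕ Θ) (svar y) ≡ Θ (svar y)
⟨⟩⊕-there {Θ} α y≢x =
  ⊕-nothing {⟨ _ ∶ α ⟩} {Θ} (svar _) (cong (if_then just α else nothing) (≢⇒≡ᵇ-false y≢x))

⟨⟩⊕-cong : ∀ {Θ₁ Θ₂ : ArCtx} x α {y} → (y ≢ x → Θ₁ (svar y) ≡ Θ₂ (svar y)) →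
  (⟨ x ∶ α ⟩ ⊕ Θ₁) (svar y) ≡ (⟨ x ∶ α ⟩ ⊕ Θ₂) (svar y)
⟨⟩⊕-cong {Θ₁} {Θ₂} x α {y} agree with y ≟ x
... | yes refl = trans (⟨⟩⊕-here {Θ₁} x α) (sym (⟨⟩⊕-here {Θ₂} x α))
... | no y≢x   = ⊕-congˡ {⟨ x ∶ α ⟩} {Θ₁} {Θ₂} (svar y) (agree y≢x)

mutual
  fv-openC⁻ : ∀ k x M {y} → y ∈ fvC (openC k x M) → y ≡ x ⊎ y ∈ fvC M
  fv-openC⁻ k x (atm R) p = fv-openR⁻ k x R p
  fv-openC⁻ k x (lam M) p = fv-openC⁻ (suc k) x M p

  fv-openR⁻ : ∀ k x R {y} → y ∈ fvR (openR k x R) → y ≡ x ⊎ y ∈ fvR R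
  fv-openR⁻ k x (fvar z) p = inj₂ p
  fv-openR⁻ k x (bvar i) p with i ≡ᵇ k
  fv-openR⁻ k x (bvar i) (here refl) | true = inj₁ refl
  fv-openR⁻ k x (app R M) p with ∈-++⁻ (fvR (openR k x R)) p
  ... | inj₁ q = Sum.map₂ ∈-++⁺ˡ (fv-openR⁻ k x R q)
  ... | inj₂ q = Sum.map₂ (∈-++⁺ʳ (fvR R)) (fv-openC⁻ k x M q)

mutual
  fv-openC⁺ : ∀ k x M {y} → y ∈ fvC M → y ∈ fvC (openC k x M)
  fv-openC⁺ k x (atm R) p = fv-openR⁺ k x R p
  fv-openC⁺ k x (lam M) p = fv-openC⁺ (suc k) x M p

  fv-openR⁺ : ∀ k x R {y} → y ∈ fvR R → y ∈ fvR (openR k x R)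
  fv-openR⁺ k x (fvar z) p = p
  fv-openR⁺ k x (app R M) p with ∈-++⁻ (fvR R) p
  ... | inj₁ q = ∈-++⁺ˡ (fv-openR⁺ k x R q)
  ... | inj₂ q = ∈-++⁺ʳ (fvR (openR k x R)) (fv-openC⁺ k x M q)

fv-openC⁻-≢ : ∀ k x M {y} → y ∈ fvC (openC k x M) → y ≢ x → y ∈ fvC M
fv-openC⁻-≢ k x M p y≢x with fv-openC⁻ k x M p
... | inj₁ y≡x = ⊥-elim (y≢x y≡x)
... | inj₂ q   = q

mutual
  LCᶜ : ℕ → Can → Set
  LCᶜ k (atm R) = LCʳ k R
  LCᶜ k (lam M) = LCᶜ (suc k) M

  LCʳ : ℕ → Atm → Set
  LCʳ k (con c)   = ⊤
  LCʳ k (fvar x)  = ⊤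
  LCʳ k (bvar i)  = i < k
  LCʳ k (app R M) = LCʳ k R × LCᶜ k M

mutual
  LCᶜ-openC : ∀ k x M → LCᶜ k (openC k x M) → LCᶜ (suc k) M
  LCᶜ-openC k x (atm R) lc = LCʳ-openR k x R lc
  LCᶜ-openC k x (lam M) lc = LCᶜ-openC (suc k) x M lc

  LCʳ-openR : ∀ k x R → LCʳ k (openR k x R) → LCʳ (suc k) R
  LCʳ-openR k x (con c)   lc = tt
  LCʳ-openR k x (fvar y)  lc = tt
  LCʳ-openR k x (bvar i)  lc with i ≟ k
  ... | yes refl = n<1+n k
  ... | no i≢k rewrite ≢⇒≡ᵇ-false i≢k = m≤n⇒m≤1+n lc
  LCʳ-openR k x (app R M) (lcR , lcM) = LCʳ-openR k x R lcR , LCᶜ-openC k x M lcM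

renᵛ : Var → Var → Var → Var
renᵛ x y z = if z ≡ᵇ x then y else z

renᵛ-here : ∀ x y → renᵛ x y x ≡ y
renᵛ-here x y rewrite ≡ᵇ-refl x = refl

renᵛ-there : ∀ {x y z} → z ≢ x → renᵛ x y z ≡ z
renᵛ-there z≢x rewrite ≢⇒≡ᵇ-false z≢x = refl

mutual
  renC : Var → Var → Can → Can
  renC x y (atm R) = atm (renR x y R)
  renC x y (lam M) = lam (renC x y M)

  renR : Var → Var → Atm → Atm
  renR x y (con c)   = con c
  renR x y (fvar z)  = fvar (renᵛ x y z)
  renR x y (bvar i)  = bvar i
  renR x y (app R M) = app (renR x y R) (renC x y M)

mutual
  closeC : ℕ → Var → Can → Can
  closeC k x (atm R) = atm (closeR k x R)
  closeC k x (lam M) = lam (closeC (suc k) x M)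

  closeR : ℕ → Var → Atm → Atm
  closeR k x (con c)   = con c
  closeR k x (fvar z)  = if z ≡ᵇ x then bvar k else fvar z
  closeR k x (bvar i)  = bvar i
  closeR k x (app R M) = app (closeR k x R) (closeC k x M)

mutual
  renC-openC : ∀ k x y z M → renC x y (openC k z M) ≡ openC k (renᵛ x y z) (renC x y M)
  renC-openC k x y z (atm R) = cong atm (renR-openR k x y z R)
  renC-openC k x y z (lam M) = cong lam (renC-openC (suc k) x y z M)

  renR-openR : ∀ k x y z R → renR x y (openR k z R) ≡ openR k (renᵛ x y z) (renR x y R)
  renR-openR k x y z (con c)   = refl
  renR-openR k x y z (fvar w)  = refl
  renR-openR k x y z (bvar i) with i ≡ᵇ k
  ... | true  = refl
  ... | false = refl
  renR-openR k x y z (app R M) = cong₂ app (renR-openR k x y z R) (renC-openC k x y z M)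

mutual
  renC-fresh : ∀ x y M → x ∉ fvC M → renC x y M ≡ M
  renC-fresh x y (atm R) x∉ = cong atm (renR-fresh x y R x∉)
  renC-fresh x y (lam M) x∉ = cong lam (renC-fresh x y M x∉)

  renR-fresh : ∀ x y R → x ∉ fvR R → renR x y R ≡ R
  renR-fresh x y (con c)   x∉ = refl
  renR-fresh x y (fvar z)  x∉ = cong fvar (renᵛ-there (x∉ ∘ here ∘ sym))
  renR-fresh x y (bvar i)  x∉ = refl
  renR-fresh x y (app R M) x∉ =
    let x∉R , x∉M = ∉-++⁻ (fvR R) x∉ in cong₂ app (renR-fresh x y R x∉R) (renC-fresh x y M x∉M)

renC-openC-self : ∀ k x y M → x ∉ fvC M → renC x y (openC k x M) ≡ openC k y M
renC-openC-self k x y M x∉ =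
  trans (renC-openC k x y x M) (cong₂ (openC k) (renᵛ-here x y) (renC-fresh x y M x∉))

renC-openC-other : ∀ k x y z M → z ≢ x → renC x y (openC k z M) ≡ openC k z (renC x y M)
renC-openC-other k x y z M z≢x =
  trans (renC-openC k x y z M) (cong (λ v → openC k v (renC x y M)) (renᵛ-there z≢x))

mutual
  fv-renC : ∀ x y M {z} → z ∈ fvC M → z ≢ x → z ∈ fvC (renC x y M)
  fv-renC x y (atm R) p z≢x = fv-renR x y R p z≢x
  fv-renC x y (lam M) p z≢x = fv-renC x y M p z≢x

  fv-renR : ∀ x y R {z} → z ∈ fvR R → z ≢ x → z ∈ fvR (renR x y R)
  fv-renR x y (fvar w) (here refl) z≢x rewrite renᵛ-there {x} {y} z≢x = here refl
  fv-renR x y (app R M) p z≢x with ∈-++⁻ (fvR R) p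
  ... | inj₁ q = ∈-++⁺ˡ (fv-renR x y R q z≢x)
  ... | inj₂ q = ∈-++⁺ʳ (fvR (renR x y R)) (fv-renC x y M q z≢x)

mutual
  openC-closeC : ∀ k x y M → LCᶜ k M → openC k y (closeC k x M) ≡ renC x y M
  openC-closeC k x y (atm R) lc = cong atm (openR-closeR k x y R lc)
  openC-closeC k x y (lam M) lc = cong lam (openC-closeC (suc k) x y M lc)

  openR-closeR : ∀ k x y R → LCʳ k R → openR k y (closeR k x R) ≡ renR x y R
  openR-closeR k x y (con c)  lc = refl
  openR-closeR k x y (fvar z) lc with z ≡ᵇ x
  ... | true rewrite ≡ᵇ-refl k = refl
  ... | false = refl
  openR-closeR k x y (bvar i) lc rewrite ≢⇒≡ᵇ-false (<⇒≢ lc) = refl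
  openR-closeR k x y (app R M) (lcR , lcM) = cong₂ app (openR-closeR k x y R lcR) (openC-closeC k x y M lcM)

mutual
  closeC-openC : ∀ k x M → x ∉ fvC M → closeC k x (openC k x M) ≡ M
  closeC-openC k x (atm R) x∉ = cong atm (closeR-openR k x R x∉)
  closeC-openC k x (lam M) x∉ = cong lam (closeC-openC (suc k) x M x∉)

  closeR-openR : ∀ k x R → x ∉ fvR R → closeR k x (openR k x R) ≡ R
  closeR-openR k x (con c)  x∉ = refl
  closeR-openR k x (fvar z) x∉ rewrite ≢⇒≡ᵇ-false (x∉ ∘ here ∘ sym) = refl
  closeR-openR k x (bvar i) x∉ with i ≟ k
  ... | yes refl rewrite ≡ᵇ-refl i | ≡ᵇ-refl x = refl
  ... | no i≢k rewrite ≢⇒≡ᵇ-false i≢k = refl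
  closeR-openR k x (app R M) x∉ =
    let x∉R , x∉M = ∉-++⁻ (fvR R) x∉ in cong₂ app (closeR-openR k x R x∉R) (closeC-openC k x M x∉M)

openC-injective : ∀ k x M N → x ∉ fvC M → x ∉ fvC N → openC k x M ≡ openC k x N → M ≡ N
openC-injective k x M N x∉M x∉N eq =
  trans (sym (closeC-openC k x M x∉M)) (trans (cong (closeC k x) eq) (closeC-openC k x N x∉N))

AgreeOn : List Var → ArCtx → ArCtx → Set
AgreeOn L Γ Γ′ = (∀ c → Γ (scon c) ≡ Γ′ (scon c)) × (∀ {y} → y ∈ L → Γ (svar y) ≡ Γ′ (svar y))

AgreeOn-⟨⟩⊕ : ∀ {Γ Γ′ : ArCtx} x α M → AgreeOn (fvC M) Γ Γ′ →
  AgreeOn (fvC (openC 0 x M)) (⟨ x ∶ α ⟩ ⊕ Γ) (⟨ x ∶ α ⟩ ⊕ Γ′)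
AgreeOn-⟨⟩⊕ x α M (agc , agv) = agc , λ p → ⟨⟩⊕-cong x α (agv ∘ fv-openC⁻-≢ 0 x M p)

mutual
  ∶-resp-AgreeOn : ∀ {Γ Γ′ M α} → Γ ⊢ M ∶ α → AgreeOn (fvC M) Γ Γ′ → Γ′ ⊢ M ∶ α
  ∶-resp-AgreeOn (ar-lam {M = M} {α₁} L ⊢M) ag =
    ar-lam L λ x x∉ → ∶-resp-AgreeOn (⊢M x x∉) (AgreeOn-⟨⟩⊕ x α₁ M ag)
  ∶-resp-AgreeOn (ar-atm ⊢R) ag = ar-atm (⇒-resp-AgreeOn ⊢R ag)

  ⇒-resp-AgreeOn : ∀ {Γ Γ′ R α} → Γ ⊢ R ⇒ α → AgreeOn (fvR R) Γ Γ′ → Γ′ ⊢ R ⇒ α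
  ⇒-resp-AgreeOn (ar-con {c = c} eq) (agc , agv) = ar-con (trans (sym (agc c)) eq)
  ⇒-resp-AgreeOn (ar-var eq) (agc , agv) = ar-var (trans (sym (agv (here refl))) eq)
  ⇒-resp-AgreeOn (ar-app {R = R} ⊢R ⊢M) (agc , agv) =
    ar-app (⇒-resp-AgreeOn ⊢R (agc , agv ∘ ∈-++⁺ˡ)) (∶-resp-AgreeOn ⊢M (agc , agv ∘ ∈-++⁺ʳ (fvR R)))

∶-weaken : ∀ {Γ M α} x β → x ∉ fvC M → Γ ⊢ M ∶ α → (⟨ x ∶ β ⟩ ⊕ Γ) ⊢ M ∶ α
∶-weaken {Γ} x β x∉ ⊢M =
  ∶-resp-AgreeOn ⊢M ((λ c → refl) , λ p → sym (⟨⟩⊕-there {Γ} β λ { refl → x∉ p }))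

mutual
  ∶⇒LCᶜ : ∀ {Γ M α} → Γ ⊢ M ∶ α → LCᶜ 0 M
  ∶⇒LCᶜ (ar-lam {M = M} L ⊢M) = let x , x∉ = fresh L in LCᶜ-openC 0 x M (∶⇒LCᶜ (⊢M x x∉))
  ∶⇒LCᶜ (ar-atm ⊢R) = ⇒⇒LCʳ ⊢R

  ⇒⇒LCʳ : ∀ {Γ R α} → Γ ⊢ R ⇒ α → LCʳ 0 R
  ⇒⇒LCʳ (ar-con _) = tt
  ⇒⇒LCʳ (ar-var _) = tt
  ⇒⇒LCʳ (ar-app ⊢R ⊢M) = ⇒⇒LCʳ ⊢R , ∶⇒LCᶜ ⊢M

∈ₛ⇒∈dom : ∀ {θ x M α} → (x , M , α) ∈ₛ θ → x ∈ dom θ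
∈ₛ⇒∈dom = ∈-map⁺ proj₁

∈dom⇒∈ₛ : ∀ {θ x} → x ∈ dom θ → ∃ λ M → ∃ λ α → (x , M , α) ∈ₛ θ
∈dom⇒∈ₛ p with ∈-map⁻ proj₁ p
... | (x , M , α) , q , refl = M , α , q

fvRng⁺ : ∀ {θ x M α y} → (x , M , α) ∈ₛ θ → y ∈ fvC M → y ∈ fvRng θ
fvRng⁺ p q = ∈-concatMap⁺ _ (lose p q)

fvRng⁻ : ∀ {θ y} → y ∈ fvRng θ → ∃ λ x → ∃ λ M → ∃ λ α → (x , M , α) ∈ₛ θ × y ∈ fvC M
fvRng⁻ {θ} p with find (∈-concatMap⁻ (fvC ∘ proj₁ ∘ proj₂) {xs = triples θ} p)
... | (x , M , α) , q , r = x , M , α , q , r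

∈ₛ-functional : ∀ {θ x M N α β} → (x , M , α) ∈ₛ θ → (x , N , β) ∈ₛ θ → M ≡ N × α ≡ β
∈ₛ-functional {mkSubst ts uniq} = go uniq
  where
  go : ∀ {ts : List Triple} {x M N α β} → Unique (map proj₁ ts) →
    (x , M , α) ∈ ts → (x , N , β) ∈ ts → M ≡ N × α ≡ β
  go (_ ∷ _)      (here refl) (here refl) = refl , refl
  go (x≢ ∷ _)     (here refl) (there q)   = ⊥-elim (All.lookup x≢ (∈-map⁺ proj₁ q) refl)
  go (x≢ ∷ _)     (there p)   (here refl) = ⊥-elim (All.lookup x≢ (∈-map⁺ proj₁ p) refl)
  go (_ ∷ uniq′)  (there p)   (there q)   = go uniq′ p q

supp : Subst → List Var
supp θ = dom θ ++ fvRng θ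

∉supp⁻ : ∀ {x} θ → x ∉ supp θ → x ∉ dom θ × x ∉ fvRng θ
∉supp⁻ θ = ∉-++⁻ (dom θ)

ctx-∈ₛ : ∀ {θ x M α} → (x , M , α) ∈ₛ θ → ctx θ (svar x) ≡ just α
ctx-∈ₛ {mkSubst _ uniq} = go uniq
  where
  go : ∀ {ts x M α} → Unique (map proj₁ ts) → (x , M , α) ∈ ts → lookupVar ts x ≡ just α
  go {(y , _) ∷ _} _ (here refl) rewrite ≡ᵇ-refl y = refl
  go (y≢ ∷ uniq′) (there p) rewrite ≢⇒≡ᵇ-false (All.lookup y≢ (∈-map⁺ proj₁ p)) = go uniq′ p

ctx-∉dom : ∀ {θ x} → x ∉ dom θ → ctx θ (svar x) ≡ nothing
ctx-∉dom {mkSubst ts _} = go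
  where
  go : ∀ {ts x} → x ∉ map proj₁ ts → lookupVar ts x ≡ nothing
  go {[]} _ = refl
  go {_ ∷ _} x∉ rewrite ≢⇒≡ᵇ-false (x∉ ∘ here ∘ sym) = go (x∉ ∘ there)

arSize : Arity → ℕ
arSize o       = 1
arSize (α ⇒ β) = suc (arSize α + arSize β)

size : Subst → ℕ
size θ = go (triples θ)
  where
  go : List Triple → ℕ
  go []                  = 0
  go ((_ , _ , α) ∷ ts) = arSize α + go ts

∈ₛ⇒≤size : ∀ {θ x M α} → (x , M , α) ∈ₛ θ → arSize α ≤ size θ
∈ₛ⇒≤size {mkSubst ((_ , _ , α) ∷ ts) (_ ∷ uniq)} (here refl) = m≤m+n (arSize α) _
∈ₛ⇒≤size {mkSubst ((_ , _ , β) ∷ ts) (_ ∷ uniq)} (there p) =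
  ≤-trans (∈ₛ⇒≤size {mkSubst ts uniq} p) (m≤n+m _ (arSize β))

size-singleton : ∀ x M α → size (singleton x M α) ≡ arSize α
size-singleton x M α = +-identityʳ (arSize α)

renᵗ : Var → Var → Triple → Triple
renᵗ x y (z , M , α) = renᵛ x y z , renC x y M , α

-- Relational, since renaming need not keep the domain of a substitution distinct.
record Renamed (x y : Var) (θ θ′ : Subst) : Set where
  constructor renamed
  field triples-Renamed : triples θ′ ≡ map (renᵗ x y) (triples θ)

module _ {x y : Var} {θ θ′ : Subst} (θ≈θ′ : Renamed x y θ θ′) where
  open Renamed θ≈θ′

  ∈ₛ-Renamed : ∀ {z M α} → (z , M , α) ∈ₛ θ → (renᵛ x y z , renC x y M , α) ∈ₛ θ′
  ∈ₛ-Renamed p = subst (_ ∈_) (sym triples-Renamed) (∈-map⁺ (renᵗ x y) p)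

  dom-Renamed : dom θ′ ≡ map (renᵛ x y) (dom θ)
  dom-Renamed = trans (cong (map proj₁) triples-Renamed)
    (trans (sym (map-∘ {g = proj₁} {f = renᵗ x y} (triples θ))) (map-∘ {g = renᵛ x y} {f = proj₁} (triples θ)))

  ∈dom-Renamed : ∀ {w} → w ∈ dom θ → w ≢ x → w ∈ dom θ′
  ∈dom-Renamed {w} p w≢x = let _ , _ , q = ∈dom⇒∈ₛ {θ} p in
    subst (_∈ dom θ′) (renᵛ-there w≢x) (∈ₛ⇒∈dom {θ′} (∈ₛ-Renamed q))

  ∈fvRng-Renamed : ∀ {w} → w ∈ fvRng θ → w ≢ x → w ∈ fvRng θ′
  ∈fvRng-Renamed p w≢x = let _ , M , _ , q , w∈M = fvRng⁻ {θ} p in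
    fvRng⁺ {θ′} (∈ₛ-Renamed q) (fv-renC x y M w∈M w≢x)

  ∉dom-Renamed : ∀ {z} → z ∉ dom θ → y ∉ dom θ → (x ∈ dom θ → z ≢ y) → renᵛ x y z ∉ dom θ′
  ∉dom-Renamed {z} z∉ y∉ guard p with ∈-map⁻ (renᵛ x y) (subst (_ ∈_) dom-Renamed p)
  ... | z′ , z′∈ , eq with z ≟ x | z′ ≟ x
  ... | yes refl | yes refl = z∉ z′∈
  ... | yes refl | no z′≢x  = y∉ (subst (_∈ dom θ) (sym (trans (sym (renᵛ-here x y)) (trans eq (renᵛ-there z′≢x)))) z′∈)
  ... | no z≢x   | yes refl = guard z′∈ (trans (sym (renᵛ-there z≢x)) (trans eq (renᵛ-here x y)))
  ... | no z≢x   | no z′≢x  = z∉ (subst (_∈ dom θ) (trans (sym (renᵛ-there z′≢x)) (trans (sym eq) (renᵛ-there z≢x))) z′∈)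

Renamed-fresh : ∀ {θ x} y → x ∉ supp θ → Renamed x y θ θ
Renamed-fresh {θ} {x} y x∉ = renamed (sym (map-id-local (All.tabulate renᵗ-id)))
  where
  x∉dom = proj₁ (∉supp⁻ θ x∉)
  x∉rng = proj₂ (∉supp⁻ θ x∉)
  renᵗ-id : ∀ {t} → t ∈ triples θ → renᵗ x y t ≡ t
  renᵗ-id {z , M , α} p =
    cong₂ _,_ (renᵛ-there λ { refl → x∉dom (∈ₛ⇒∈dom {θ} p) })
              (cong (_, α) (renC-fresh x y M (x∉rng ∘ fvRng⁺ {θ} p)))

Renamed-singleton : ∀ {x y w} M α → w ≢ x → Renamed x y (singleton w M α) (singleton w (renC x y M) α)
Renamed-singleton M α w≢x = renamed (cong (λ v → (v , _ , α) ∷ []) (sym (renᵛ-there w≢x)))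

∉-[_] : ∀ {x : Var} w → x ≢ w → x ∉ w ∷ []
∉-[ w ] x≢w (here x≡w) = x≢w x≡w

mutual
  SubC-Renamed : ∀ {θ θ′ M M′} x y → Renamed x y θ θ′ → y ∉ dom θ → (x ∈ dom θ → y ∉ fvC M) →
    SubC θ M M′ → SubC θ′ (renC x y M) (renC x y M′)
  SubC-Renamed x y θ≈θ′ y∉ guard (hs-atm hR)   = hs-atm (SubR-Renamed x y θ≈θ′ y∉ guard hR)
  SubC-Renamed x y θ≈θ′ y∉ guard (hs-atmrc hR) = hs-atmrc (SubRC-Renamed x y θ≈θ′ y∉ guard hR)
  SubC-Renamed {θ′ = θ′} x y θ≈θ′ y∉ guard (hs-lam {M = M} {M′} L hM) =
    hs-lam (x ∷ y ∷ L) λ w w∉ w∉dom w∉rng →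
      let w≢x , w∉ = ∉-∷⁻ w∉
          w≢y , w∉L = ∉-∷⁻ w∉
      in subst₂ (SubC θ′) (renC-openC-other 0 x y w M w≢x) (renC-openC-other 0 x y w M′ w≢x)
           (SubC-Renamed x y θ≈θ′ y∉ (λ x∈ y∈ → guard x∈ (fv-openC⁻-≢ 0 w M y∈ (w≢y ∘ sym)))
             (hM w w∉L (w∉dom ∘ λ p → ∈dom-Renamed θ≈θ′ p w≢x) (w∉rng ∘ λ p → ∈fvRng-Renamed θ≈θ′ p w≢x)))

  SubRC-Renamed : ∀ {θ θ′ R M α} x y → Renamed x y θ θ′ → y ∉ dom θ → (x ∈ dom θ → y ∉ fvR R) →
    SubRC θ R M α → SubRC θ′ (renR x y R) (renC x y M) α
  SubRC-Renamed x y θ≈θ′ y∉ guard (hs-var p) = hs-var (∈ₛ-Renamed θ≈θ′ p)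
  SubRC-Renamed x y θ≈θ′ y∉ guard (hs-app {R = R} {N = N} {M″ = M″} {M‴} {α′} L hR hM hN) =
    hs-app (x ∷ y ∷ L)
      (SubRC-Renamed x y θ≈θ′ y∉ (λ x∈ → guard x∈ ∘ ∈-++⁺ˡ) hR)
      (SubC-Renamed x y θ≈θ′ y∉ (λ x∈ → guard x∈ ∘ ∈-++⁺ʳ (fvR R)) hM)
      λ w w∉ →
        let w≢x , w∉ = ∉-∷⁻ w∉
            w≢y , w∉L = ∉-∷⁻ w∉
        in subst (λ v → SubC (singleton w (renC x y M″) α′) v (renC x y M‴))
             (renC-openC-other 0 x y w N w≢x)
             (SubC-Renamed x y (Renamed-singleton M″ α′ w≢x) (∉-[ w ] (w≢y ∘ sym))
               (λ x∈ → ⊥-elim (∉-[ w ] (w≢x ∘ sym) x∈)) (hN w w∉L))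

  SubR-Renamed : ∀ {θ θ′ R R′} x y → Renamed x y θ θ′ → y ∉ dom θ → (x ∈ dom θ → y ∉ fvR R) →
    SubR θ R R′ → SubR θ′ (renR x y R) (renR x y R′)
  SubR-Renamed x y θ≈θ′ y∉ guard hs-con = hs-con
  SubR-Renamed x y θ≈θ′ y∉ guard (hs-fvar z∉) =
    hs-fvar (∉dom-Renamed θ≈θ′ z∉ y∉ λ x∈ z≡y → guard x∈ (here (sym z≡y)))
  SubR-Renamed x y θ≈θ′ y∉ guard (hs-app {R = R} hR hM) =
    hs-app (SubR-Renamed x y θ≈θ′ y∉ (λ x∈ → guard x∈ ∘ ∈-++⁺ˡ) hR)
           (SubC-Renamed x y θ≈θ′ y∉ (λ x∈ → guard x∈ ∘ ∈-++⁺ʳ (fvR R)) hM)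

SubR-SubRC-exclusive : ∀ {θ R R′ M α} → SubR θ R R′ → SubRC θ R M α → ⊥
SubR-SubRC-exclusive {θ} (hs-fvar x∉) (hs-var p) = x∉ (∈ₛ⇒∈dom {θ} p)
SubR-SubRC-exclusive (hs-app hR _) (hs-app _ hR′ _ _) = SubR-SubRC-exclusive hR hR′

mutual
  SubC-functional : ∀ {θ M A B} → SubC θ M A → SubC θ M B → A ≡ B
  SubC-functional (hs-atm h)   (hs-atm h′)   = cong atm (SubR-functional h h′)
  SubC-functional (hs-atm h)   (hs-atmrc h′) = ⊥-elim (SubR-SubRC-exclusive h h′)
  SubC-functional (hs-atmrc h) (hs-atm h′)   = ⊥-elim (SubR-SubRC-exclusive h′ h)
  SubC-functional (hs-atmrc h) (hs-atmrc h′) = proj₁ (SubRC-functional h h′)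
  SubC-functional {θ} {lam M} {lam A} {lam B} (hs-lam L h) (hs-lam L′ h′) =
    let x , x∉ = fresh (L ++ L′ ++ supp θ ++ fvC A ++ fvC B)
        x∉L , x∉ = ∉-++⁻ L x∉
        x∉L′ , x∉ = ∉-++⁻ L′ x∉
        x∉θ , x∉ = ∉-++⁻ (supp θ) x∉
        x∉dom , x∉rng = ∉supp⁻ θ x∉θ
        x∉A , x∉B = ∉-++⁻ (fvC A) x∉
    in cong lam (openC-injective 0 x A B x∉A x∉B
         (SubC-functional (h x x∉L x∉dom x∉rng) (h′ x x∉L′ x∉dom x∉rng)))

  SubRC-functional : ∀ {θ R A B α β} → SubRC θ R A α → SubRC θ R B β → A ≡ B × α ≡ β
  SubRC-functional {θ} (hs-var p) (hs-var q) = ∈ₛ-functional {θ} p q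
  SubRC-functional (hs-app L hR hM hN) (hs-app L′ hR′ hM′ hN′)
    with SubRC-functional hR hR′ | SubC-functional hM hM′
  ... | refl , refl | refl =
    let x , x∉ = fresh (L ++ L′); x∉L , x∉L′ = ∉-++⁻ L x∉
    in SubC-functional (hN x x∉L) (hN′ x x∉L′) , refl

  SubR-functional : ∀ {θ R A B} → SubR θ R A → SubR θ R B → A ≡ B
  SubR-functional hs-con         hs-con           = refl
  SubR-functional (hs-fvar _)    (hs-fvar _)      = refl
  SubR-functional (hs-app hR hM) (hs-app hR′ hM′) = cong₂ app (SubR-functional hR hR′) (SubC-functional hM hM′)

FvOrigin : Subst → List Var → Var → Set
FvOrigin θ L y = (y ∈ L × y ∉ dom θ) ⊎ y ∈ fvRng θ

mutual
  fv-SubC : ∀ {θ M M′ y} → SubC θ M M′ → y ∈ fvC M′ → FvOrigin θ (fvC M) y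
  fv-SubC (hs-atm h)   p = fv-SubR h p
  fv-SubC (hs-atmrc h) p = fv-SubRC h p
  fv-SubC {θ} {lam M} {lam M′} {y} (hs-lam L h) p =
    let w , w∉ = fresh (y ∷ L ++ supp θ)
        w≢y , w∉ = ∉-∷⁻ w∉
        w∉L , w∉θ = ∉-++⁻ L w∉
        w∉dom , w∉rng = ∉supp⁻ θ w∉θ
    in Sum.map₁ (Product.map₁ λ q → fv-openC⁻-≢ 0 w M q (w≢y ∘ sym))
         (fv-SubC (h w w∉L w∉dom w∉rng) (fv-openC⁺ 0 w M′ p))

  fv-SubRC : ∀ {θ R M α y} → SubRC θ R M α → y ∈ fvC M → FvOrigin θ (fvR R) y
  fv-SubRC {θ} (hs-var p) q = inj₂ (fvRng⁺ {θ} p q)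
  fv-SubRC {R = app R M} {y = y} (hs-app {N = N} {M″ = M″} L hR hM hN) p
    with fresh (y ∷ L)
  ... | w , w∉ with ∉-∷⁻ w∉
  ... | w≢y , w∉L with fv-SubC (hN w w∉L) p
  ... | inj₁ (q , _) =
    Sum.map₁ (Product.map₁ ∈-++⁺ˡ) (fv-SubRC hR (fv-openC⁻-≢ 0 w N q (w≢y ∘ sym)))
  ... | inj₂ q =
    Sum.map₁ (Product.map₁ (∈-++⁺ʳ (fvR R))) (fv-SubC hM (subst (y ∈_) (++-identityʳ (fvC M″)) q))

  fv-SubR : ∀ {θ R R′ y} → SubR θ R R′ → y ∈ fvR R′ → FvOrigin θ (fvR R) y
  fv-SubR (hs-fvar x∉) (here refl) = inj₁ (here refl , x∉)
  fv-SubR {R = app R M} (hs-app {R′ = R′} hR hM) p with ∈-++⁻ (fvR R′) p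
  ... | inj₁ q = Sum.map₁ (Product.map₁ ∈-++⁺ˡ) (fv-SubR hR q)
  ... | inj₂ q = Sum.map₁ (Product.map₁ (∈-++⁺ʳ (fvR R))) (fv-SubC hM q)

mutual
  SubC-id : ∀ {Γ θ M α} → Γ ⊢ M ∶ α → (∀ {y} → y ∈ fvC M → y ∉ dom θ) → SubC θ M M
  SubC-id (ar-atm ⊢R) disj = hs-atm (SubR-id ⊢R disj)
  SubC-id (ar-lam {M = M} L ⊢M) disj =
    hs-lam L λ x x∉L x∉dom _ → SubC-id (⊢M x x∉L) λ p → [ (λ { refl → x∉dom }) , disj ] (fv-openC⁻ 0 x M p)

  SubR-id : ∀ {Γ θ R α} → Γ ⊢ R ⇒ α → (∀ {y} → y ∈ fvR R → y ∉ dom θ) → SubR θ R R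
  SubR-id (ar-con _) disj = hs-con
  SubR-id (ar-var _) disj = hs-fvar (disj (here refl))
  SubR-id (ar-app {R = R} ⊢R ⊢M) disj = hs-app (SubR-id ⊢R (disj ∘ ∈-++⁺ˡ)) (SubC-id ⊢M (disj ∘ ∈-++⁺ʳ (fvR R)))

SubC-open-rename : ∀ {θ M P x₀} → x₀ ∉ supp θ → x₀ ∉ fvC M → LCᶜ 0 P →
  SubC θ (openC 0 x₀ M) P → ∀ {y} → y ∉ dom θ → SubC θ (openC 0 y M) (openC 0 y (closeC 0 x₀ P))
SubC-open-rename {θ} {M} {P} {x₀} x₀∉ x₀∉M lcP hP {y} y∉dom =
  subst₂ (SubC θ) (renC-openC-self 0 x₀ y M x₀∉M) (sym (openC-closeC 0 x₀ y P lcP))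
    (SubC-Renamed x₀ y (Renamed-fresh y x₀∉) y∉dom (⊥-elim ∘ proj₁ (∉supp⁻ θ x₀∉)) hP)

∉fv-SubC-singleton : ∀ {z M α T T′} → z ∉ fvC M → SubC (singleton z M α) T T′ → z ∉ fvC T′
∉fv-SubC-singleton {M = M} z∉M h p with fv-SubC h p
... | inj₁ (_ , z∉dom) = z∉dom (here refl)
... | inj₂ q = z∉M (subst (_ ∈_) (++-identityʳ (fvC M)) q)

SubC-singleton-rename : ∀ {z₀ N M M‴ α} → z₀ ∉ fvC N → z₀ ∉ fvC M →
  SubC (singleton z₀ M α) (openC 0 z₀ N) M‴ → ∀ z → z ∉ z₀ ∷ fvC N → SubC (singleton z M α) (openC 0 z N) M‴
SubC-singleton-rename {z₀} {N} {M} {M‴} {α} z₀∉N z₀∉M hN z z∉ =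
  let z≢z₀ , z∉N = ∉-∷⁻ z∉ in
  subst₂ (SubC (singleton z M α)) (renC-openC-self 0 z₀ z N z₀∉N)
    (renC-fresh z₀ z M‴ (∉fv-SubC-singleton z₀∉M hN))
    (SubC-Renamed z₀ z (renamed (cong₂ (λ v N′ → (v , N′ , α) ∷ []) (sym (renᵛ-here z₀ z)) (sym (renC-fresh z₀ z M z₀∉M))))
       (∉-[ z₀ ] z≢z₀) (λ _ z∈ → z∉N (fv-openC⁻-≢ 0 z₀ N z∈ z≢z₀)) hN)

record WellTyped (θ : Subst) (Γ Δ : ArCtx) : Set where
  field
    entry     : ∀ {x M α} → (x , M , α) ∈ₛ θ → Γ (svar x) ≡ just α × Δ ⊢ M ∶ α
    agree-con : ∀ c → Γ (scon c) ≡ Δ (scon c)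
    agree-off : ∀ {x} → x ∉ dom θ → Γ (svar x) ≡ Δ (svar x)
open WellTyped

WellTyped-⟨⟩⊕ : ∀ {θ Γ Δ} x α → x ∉ supp θ → WellTyped θ Γ Δ →
  WellTyped θ (⟨ x ∶ α ⟩ ⊕ Γ) (⟨ x ∶ α ⟩ ⊕ Δ)
WellTyped-⟨⟩⊕ {θ} {Γ} {Δ} x α x∉ wt = let x∉dom , x∉rng = ∉supp⁻ θ x∉ in record
  { entry     = λ p → let Γx , ⊢M = entry wt p in
                  trans (⟨⟩⊕-there {Γ} α λ { refl → x∉dom (∈ₛ⇒∈dom {θ} p) }) Γx ,
                  ∶-weaken x α (x∉rng ∘ fvRng⁺ {θ} p) ⊢M
  ; agree-con = agree-con wt
  ; agree-off = λ y∉ → ⟨⟩⊕-cong {Γ} {Δ} x α λ _ → agree-off wt y∉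
  }

WellTyped-singleton : ∀ {Δ M α} z → Δ ⊢ M ∶ α → WellTyped (singleton z M α) (⟨ z ∶ α ⟩ ⊕ Δ) Δ
WellTyped-singleton {Δ} {α = α} z ⊢M = record
  { entry     = λ { (here refl) → ⟨⟩⊕-here {Δ} z α , ⊢M }
  ; agree-con = λ c → refl
  ; agree-off = λ y∉ → ⟨⟩⊕-there {Δ} α (y∉ ∘ here)
  }

SubRC-size : ∀ {θ R M α} → SubRC θ R M α → arSize α ≤ size θ
SubRC-size {θ} (hs-var p) = ∈ₛ⇒≤size {θ} p
SubRC-size (hs-app {α′ = α′} {α″} L hR _ _) =
  ≤-trans (m≤n⇒m≤1+n (m≤n+m (arSize α″) (arSize α′))) (SubRC-size hR)

SubRC-arg-size : ∀ {θ R M α′ α} → SubRC θ R M (α′ ⇒ α) → arSize α′ < size θ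
SubRC-arg-size {α′ = α′} hR = ≤-trans (s≤s (m≤m+n (arSize α′) _)) (SubRC-size hR)

SubCResult : Subst → ArCtx → Can → Arity → Set
SubCResult θ Δ M α = ∃ λ M′ → SubC θ M M′ × Δ ⊢ M′ ∶ α

SubRResult : Subst → ArCtx → Atm → Arity → Set
SubRResult θ Δ R α = (∃ λ R′ → SubR θ R R′ × Δ ⊢ R′ ⇒ α) ⊎ (∃ λ M′ → SubRC θ R M′ α × Δ ⊢ M′ ∶ α)

Total : ℕ → Set
Total n = ∀ {θ Γ Δ} → size θ ≤ n → WellTyped θ Γ Δ →
  (∀ {M α} → Γ ⊢ M ∶ α → SubCResult θ Δ M α) × (∀ {R α} → Γ ⊢ R ⇒ α → SubRResult θ Δ R α)

total-step : ∀ n → (∀ {m} → m < n → Total m) → Total n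
total-step n rec {θ} θ≤n wt₀ = exists-C wt₀ , exists-R wt₀
  where
  mutual
    exists-C : ∀ {Γ Δ M α} → WellTyped θ Γ Δ → Γ ⊢ M ∶ α → SubCResult θ Δ M α
    exists-C wt (ar-atm ⊢R) with exists-R wt ⊢R
    ... | inj₁ (R′ , hR , ⊢R′) = atm R′ , hs-atm hR , ar-atm ⊢R′
    ... | inj₂ (M′ , hR , ⊢M′) = M′ , hs-atmrc hR , ⊢M′
    exists-C {Δ = Δ} wt (ar-lam {M = M} {α₁} {α₂} L ⊢M) =
      let x₀ , x₀∉ = fresh (L ++ supp θ ++ fvC M)
          x₀∉L , x₀∉ = ∉-++⁻ L x₀∉
          x₀∉θ , x₀∉M = ∉-++⁻ (supp θ) x₀∉
          P , hP , ⊢P = exists-C (WellTyped-⟨⟩⊕ x₀ α₁ x₀∉θ wt) (⊢M x₀ x₀∉L)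
          hopen = SubC-open-rename x₀∉θ x₀∉M (∶⇒LCᶜ ⊢P) hP
      in lam (closeC 0 x₀ P) , hs-lam [] (λ y _ y∉dom _ → hopen y∉dom) ,
         ar-lam (L ++ supp θ) λ y y∉ →
           let y∉L , y∉θ = ∉-++⁻ L y∉
               P′ , hP′ , ⊢P′ = exists-C (WellTyped-⟨⟩⊕ y α₁ y∉θ wt) (⊢M y y∉L)
           in subst (λ v → (⟨ y ∶ α₁ ⟩ ⊕ Δ) ⊢ v ∶ α₂)
                (SubC-functional hP′ (hopen (proj₁ (∉supp⁻ θ y∉θ)))) ⊢P′

    exists-R : ∀ {Γ Δ R α} → WellTyped θ Γ Δ → Γ ⊢ R ⇒ α → SubRResult θ Δ R α
    exists-R wt (ar-con {c} Γc) = inj₁ (con c , hs-con , ar-con (trans (sym (agree-con wt c)) Γc))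
    exists-R wt (ar-var {x} Γx) with x ∈? dom θ
    ... | no x∉ = inj₁ (fvar x , hs-fvar x∉ , ar-var (trans (sym (agree-off wt x∉)) Γx))
    ... | yes x∈ with ∈dom⇒∈ₛ {θ} x∈
    ... | M , α′ , p with entry wt p
    ... | Γx′ , ⊢M rewrite just-injective (trans (sym Γx′) Γx) = inj₂ (M , hs-var p , ⊢M)
    exists-R wt (ar-app ⊢R ⊢M) with exists-R wt ⊢R | exists-C wt ⊢M
    ... | inj₁ (R′ , hR , ⊢R′) | M′ , hM , ⊢M′ = inj₁ (app R′ M′ , hs-app hR hM , ar-app ⊢R′ ⊢M′)
    ... | inj₂ (_ , hR , ar-lam {M = N} L ⊢N) | M′ , hM , ⊢M′ =
      let z₀ , z₀∉ = fresh (L ++ fvC N ++ fvC M′)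
          z₀∉L , z₀∉ = ∉-++⁻ L z₀∉
          z₀∉N , z₀∉M′ = ∉-++⁻ (fvC N) z₀∉
          smaller = <-≤-trans (subst (_< size θ) (sym (size-singleton z₀ M′ _)) (SubRC-arg-size hR)) θ≤n
          M‴ , hN , ⊢M‴ = proj₁ (rec smaller ≤-refl (WellTyped-singleton z₀ ⊢M′)) (⊢N z₀ z₀∉L)
      in inj₂ (M‴ , hs-app (z₀ ∷ fvC N) hR hM (SubC-singleton-rename z₀∉N z₀∉M′ hN) , ⊢M‴)

total : ∀ n → Total n
total = <-rec Total total-step

SubC-exists : ∀ {θ Γ Δ M α} → WellTyped θ Γ Δ → Γ ⊢ M ∶ α → SubCResult θ Δ M α
SubC-exists {θ} wt = proj₁ (total (size θ) ≤-refl wt)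

SubR-exists : ∀ {θ Γ Δ R α} → WellTyped θ Γ Δ → Γ ⊢ R ⇒ α → SubRResult θ Δ R α
SubR-exists {θ} wt = proj₂ (total (size θ) ≤-refl wt)

SubC-preserves : ∀ {θ Γ Δ M M′ α} → WellTyped θ Γ Δ → SubC θ M M′ → Γ ⊢ M ∶ α → Δ ⊢ M′ ∶ α
SubC-preserves {Δ = Δ} wt h ⊢M =
  let _ , h′ , ⊢M′ = SubC-exists wt ⊢M in subst (λ v → Δ ⊢ v ∶ _) (SubC-functional h′ h) ⊢M′

SubRC-preserves : ∀ {θ Γ Δ R M α β} → WellTyped θ Γ Δ → SubRC θ R M α → Γ ⊢ R ⇒ β → α ≡ β × Δ ⊢ M ∶ α
SubRC-preserves wt h ⊢R with SubR-exists wt ⊢R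
... | inj₁ (_ , h′ , _) = ⊥-elim (SubR-SubRC-exclusive h′ h)
... | inj₂ (_ , h′ , ⊢M) with SubRC-functional h′ h
... | refl , refl = refl , ⊢M


∉dom-∘ : ∀ {θ₁ θ₂ θ x} → IsComposition θ₂ θ₁ θ → x ∉ dom θ₁ → x ∉ dom θ₂ → x ∉ dom θ
∉dom-∘ {θ₁} {θ₂} {θ} ic x∉₁ x∉₂ x∈ with ∈dom⇒∈ₛ {θ} x∈
... | M , α , p with Equivalence.to (ic _ M α) p
... | inj₁ (_ , q , _) = x∉₁ (∈ₛ⇒∈dom {θ₁} q)
... | inj₂ (q , _)     = x∉₂ (∈ₛ⇒∈dom {θ₂} q)

∉fvRng-∘ : ∀ {θ₁ θ₂ θ x} → IsComposition θ₂ θ₁ θ → x ∉ fvRng θ₁ → x ∉ fvRng θ₂ → x ∉ fvRng θ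
∉fvRng-∘ {θ₁} {θ₂} {θ} ic x∉₁ x∉₂ x∈ with fvRng⁻ {θ} x∈
... | z , N′ , γ , p , x∈N′ with Equivalence.to (ic z N′ γ) p
... | inj₂ (q , _) = x∉₂ (fvRng⁺ {θ₂} q x∈N′)
... | inj₁ (N , q , h) with fv-SubC h x∈N′
... | inj₁ (x∈N , _) = x∉₁ (fvRng⁺ {θ₁} q x∈N)
... | inj₂ x∈rng₂    = x∉₂ x∈rng₂

∈-∘ : Subst → Subst → Var → Can → Arity → Set
∈-∘ θ₂ θ₁ x M′ α = (∃ λ M → ((x , M , α) ∈ₛ θ₁) × SubC θ₂ M M′) ⊎ (((x , M′ , α) ∈ₛ θ₂) × x ∉ dom θ₁)

extend : (x : Var) → Can → Arity → (θ : Subst) → x ∉ dom θ → Subst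
extend x P β θ x∉ = mkSubst ((x , P , β) ∷ triples θ) (¬Any⇒All¬ (dom θ) x∉ ∷ distinct θ)

IsComposition-singleton : ∀ {θ₂ x M M′ α} (x∉ : x ∉ dom θ₂) → SubC θ₂ M M′ →
  IsComposition θ₂ (singleton x M α) (extend x M′ α θ₂ x∉)
IsComposition-singleton {θ₂} {x} {M} {M′} {α} x∉ h y N γ = mk⇔ to from
  where
  to : (y , N , γ) ∈ₛ extend x M′ α θ₂ x∉ → ∈-∘ θ₂ (singleton x M α) y N γ
  to (here refl) = inj₁ (M , here refl , h)
  to (there p)   = inj₂ (p , ∉-[ x ] λ { refl → x∉ (∈ₛ⇒∈dom {θ₂} p) })
  from : ∈-∘ θ₂ (singleton x M α) y N γ → (y , N , γ) ∈ₛ extend x M′ α θ₂ x∉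
  from (inj₁ (_ , here refl , h′)) = here (cong (λ v → x , v , α) (SubC-functional h′ h))
  from (inj₂ (p , _))              = there p

IsComposition-extend : ∀ {θ Γ Δ x P β} (x∉ : x ∉ supp θ) → WellTyped θ Γ Δ →
  IsComposition (singleton x P β) θ (extend x P β θ (proj₁ (∉supp⁻ θ x∉)))
IsComposition-extend {θ} {x = x} {P} {β} x∉ wt y N γ = mk⇔ to from
  where
  x∉dom = proj₁ (∉supp⁻ θ x∉)
  x∉rng = proj₂ (∉supp⁻ θ x∉)
  unchanged : ∀ {z N γ} → (z , N , γ) ∈ₛ θ → SubC (singleton x P β) N N
  unchanged p = SubC-id (proj₂ (entry wt p)) λ y∈ → ∉-[ x ] λ { refl → x∉rng (fvRng⁺ {θ} p y∈) }
  to : (y , N , γ) ∈ₛ extend x P β θ x∉dom → ∈-∘ (singleton x P β) θ y N γ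
  to (here refl) = inj₂ (here refl , x∉dom)
  to (there p)   = inj₁ (N , p , unchanged p)
  from : ∈-∘ (singleton x P β) θ y N γ → (y , N , γ) ∈ₛ extend x P β θ x∉dom
  from (inj₁ (_ , p , h))      = there (subst (λ v → (y , v , γ) ∈ₛ θ) (SubC-functional (unchanged p) h) p)
  from (inj₂ (here refl , _)) = here refl

Composes : ℕ → Set
Composes n = ∀ {θ₁ θ₂ θ Γ Γ₁ Γ₂} → size θ₁ + size θ₂ ≤ n →
  WellTyped θ₁ Γ Γ₁ → WellTyped θ₂ Γ₁ Γ₂ → IsComposition θ₂ θ₁ θ →
    (∀ {M M′ M″ α} → Γ ⊢ M ∶ α → SubC θ₁ M M′ → SubC θ₂ M′ M″ → SubC θ M M″)
  × (∀ {R M′ M″ α β} → Γ ⊢ R ⇒ β → SubRC θ₁ R M′ α → SubC θ₂ M′ M″ → SubRC θ R M″ α)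
  × (∀ {R R′ M″ α β} → Γ ⊢ R ⇒ β → SubR θ₁ R R′ → SubRC θ₂ R′ M″ α → SubRC θ R M″ α)
  × (∀ {R R′ R″ β} → Γ ⊢ R ⇒ β → SubR θ₁ R R′ → SubR θ₂ R′ R″ → SubR θ R R″)

-- Both [x ↦ P′] ∘ θ₂ and θ₂ ∘ [x ↦ P] are θ₂ ∪ [x ↦ P′]; the induction hypothesis
-- for each of these two smaller compositions computes its action on N.
SubC-singleton-commute : ∀ {n} → (∀ {m} → m < n → Composes m) →
  ∀ {θ₂ Γ₁ Γ₂ x P P′ α N N′ N″ N₂ β} → arSize α + size θ₂ < n →
  WellTyped θ₂ Γ₁ Γ₂ → x ∉ supp θ₂ → Γ₁ ⊢ P ∶ α → (⟨ x ∶ α ⟩ ⊕ Γ₁) ⊢ N ∶ β →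
  SubC θ₂ P P′ → SubC (singleton x P α) N N′ → SubC θ₂ N′ N″ → SubC θ₂ N N₂ →
  SubC (singleton x P′ α) N₂ N″
SubC-singleton-commute IH {θ₂} {Γ₁} {Γ₂} {x} {P} {P′} {α} {N} {N′} {N″} {N₂}
    smaller wt₂ x∉ ⊢P ⊢N hP hN′ hN″ hN₂ =
  subst (SubC (singleton x P′ α) N₂) (SubC-functional via-θ₂-first via-σ-first) hK
  where
  x∉dom = proj₁ (∉supp⁻ θ₂ x∉)
  θ = extend x P′ α θ₂ x∉dom
  wt₂ˣ : WellTyped θ₂ (⟨ x ∶ α ⟩ ⊕ Γ₁) (⟨ x ∶ α ⟩ ⊕ Γ₂)
  wt₂ˣ = WellTyped-⟨⟩⊕ x α x∉ wt₂
  wtσ′ : WellTyped (singleton x P′ α) (⟨ x ∶ α ⟩ ⊕ Γ₂) Γ₂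
  wtσ′ = WellTyped-singleton x (SubC-preserves wt₂ hP ⊢P)
  K : Can
  K = proj₁ (SubC-exists wtσ′ (SubC-preserves wt₂ˣ hN₂ ⊢N))
  hK : SubC (singleton x P′ α) N₂ K
  hK = proj₁ (proj₂ (SubC-exists wtσ′ (SubC-preserves wt₂ˣ hN₂ ⊢N)))
  via-σ-first : SubC θ N N″
  via-σ-first = proj₁ (IH smaller (≤-reflexive (cong (_+ size θ₂) (size-singleton x P α)))
                  (WellTyped-singleton x ⊢P) wt₂ (IsComposition-singleton x∉dom hP)) ⊢N hN′ hN″
  via-θ₂-first : SubC θ N K
  via-θ₂-first = proj₁ (IH smaller (≤-reflexive size-θ₂∘σ′) wt₂ˣ wtσ′ (IsComposition-extend x∉ wt₂)) ⊢N hN₂ hK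
    where
    size-θ₂∘σ′ : size θ₂ + size (singleton x P′ α) ≡ arSize α + size θ₂
    size-θ₂∘σ′ = trans (cong (size θ₂ +_) (size-singleton x P′ α)) (+-comm (size θ₂) (arSize α))

compose-step : ∀ n → (∀ {m} → m < n → Composes m) → Composes n
compose-step n IH {θ₁} {θ₂} {θ} θ₁θ₂≤n wt₁₀ wt₂₀ ic =
  comp-C wt₁₀ wt₂₀ , comp-RC-C wt₁₀ wt₂₀ , comp-R-RC wt₁₀ wt₂₀ , comp-R-R wt₁₀ wt₂₀
  where
  mutual
    comp-C : ∀ {Γ Γ₁ Γ₂ M M′ M″ α} → WellTyped θ₁ Γ Γ₁ → WellTyped θ₂ Γ₁ Γ₂ → Γ ⊢ M ∶ α →
      SubC θ₁ M M′ → SubC θ₂ M′ M″ → SubC θ M M″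
    comp-C wt₁ wt₂ (ar-atm ⊢R) (hs-atm h₁)   (hs-atm h₂)   = hs-atm (comp-R-R wt₁ wt₂ ⊢R h₁ h₂)
    comp-C wt₁ wt₂ (ar-atm ⊢R) (hs-atm h₁)   (hs-atmrc h₂) = hs-atmrc (comp-R-RC wt₁ wt₂ ⊢R h₁ h₂)
    comp-C wt₁ wt₂ (ar-atm ⊢R) (hs-atmrc h₁) h₂            = hs-atmrc (comp-RC-C wt₁ wt₂ ⊢R h₁ h₂)
    comp-C wt₁ wt₂ (ar-lam {α₁ = α₁} L ⊢M) (hs-lam L₁ h₁) (hs-lam L₂ h₂) =
      hs-lam (L ++ L₁ ++ L₂ ++ supp θ₁ ++ supp θ₂) λ x x∉ _ _ →
        let x∉L , x∉ = ∉-++⁻ L x∉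
            x∉L₁ , x∉ = ∉-++⁻ L₁ x∉
            x∉L₂ , x∉ = ∉-++⁻ L₂ x∉
            x∉θ₁ , x∉θ₂ = ∉-++⁻ (supp θ₁) x∉
        in comp-C (WellTyped-⟨⟩⊕ x α₁ x∉θ₁ wt₁) (WellTyped-⟨⟩⊕ x α₁ x∉θ₂ wt₂) (⊢M x x∉L)
             (uncurry (h₁ x x∉L₁) (∉supp⁻ θ₁ x∉θ₁)) (uncurry (h₂ x x∉L₂) (∉supp⁻ θ₂ x∉θ₂))

    comp-RC-C : ∀ {Γ Γ₁ Γ₂ R M′ M″ α β} → WellTyped θ₁ Γ Γ₁ → WellTyped θ₂ Γ₁ Γ₂ → Γ ⊢ R ⇒ β →
      SubRC θ₁ R M′ α → SubC θ₂ M′ M″ → SubRC θ R M″ α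
    comp-RC-C wt₁ wt₂ ⊢R (hs-var {x = x} {M = M′} {α = α} p) h₂ =
      hs-var (Equivalence.from (ic x _ α) (inj₁ (M′ , p , h₂)))
    comp-RC-C wt₁ wt₂ (ar-app ⊢R ⊢M) (hs-app L hR hM hN) hN″ with SubRC-preserves wt₁ hR ⊢R
    ... | refl , ⊢lam@(ar-lam LN ⊢N)
      with SubC-exists wt₂ ⊢lam | SubC-exists wt₂ (SubC-preserves wt₁ hM ⊢M)
    ... | _ , hs-lam L₂ hN₂ , _ | _ , hM′ , _ =
      hs-app (L ++ L₂ ++ LN ++ supp θ₂) (comp-RC-C wt₁ wt₂ ⊢R hR (hs-lam L₂ hN₂)) (comp-C wt₁ wt₂ ⊢M hM hM′)
        λ x x∉ →
          let x∉L , x∉ = ∉-++⁻ L x∉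
              x∉L₂ , x∉ = ∉-++⁻ L₂ x∉
              x∉LN , x∉θ₂ = ∉-++⁻ LN x∉
          in SubC-singleton-commute IH (<-≤-trans (+-monoˡ-< (size θ₂) (SubRC-arg-size hR)) θ₁θ₂≤n)
               wt₂ x∉θ₂ (SubC-preserves wt₁ hM ⊢M) (⊢N x x∉LN) hM′ (hN x x∉L) hN″
               (uncurry (hN₂ x x∉L₂) (∉supp⁻ θ₂ x∉θ₂))

    comp-R-RC : ∀ {Γ Γ₁ Γ₂ R R′ M″ α β} → WellTyped θ₁ Γ Γ₁ → WellTyped θ₂ Γ₁ Γ₂ → Γ ⊢ R ⇒ β →
      SubR θ₁ R R′ → SubRC θ₂ R′ M″ α → SubRC θ R M″ α
    comp-R-RC wt₁ wt₂ ⊢R (hs-fvar {x = x} x∉) (hs-var {M = M″} {α = α} p) =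
      hs-var (Equivalence.from (ic x M″ α) (inj₂ (p , x∉)))
    comp-R-RC wt₁ wt₂ (ar-app ⊢R ⊢M) (hs-app hR₁ hM₁) (hs-app L hR₂ hM₂ hN) =
      hs-app L (comp-R-RC wt₁ wt₂ ⊢R hR₁ hR₂) (comp-C wt₁ wt₂ ⊢M hM₁ hM₂) hN

    comp-R-R : ∀ {Γ Γ₁ Γ₂ R R′ R″ β} → WellTyped θ₁ Γ Γ₁ → WellTyped θ₂ Γ₁ Γ₂ → Γ ⊢ R ⇒ β →
      SubR θ₁ R R′ → SubR θ₂ R′ R″ → SubR θ R R″
    comp-R-R wt₁ wt₂ ⊢R hs-con hs-con = hs-con
    comp-R-R wt₁ wt₂ ⊢R (hs-fvar x∉₁) (hs-fvar x∉₂) = hs-fvar (∉dom-∘ {θ₁} {θ₂} {θ} ic x∉₁ x∉₂)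
    comp-R-R wt₁ wt₂ (ar-app ⊢R ⊢M) (hs-app hR₁ hM₁) (hs-app hR₂ hM₂) =
      hs-app (comp-R-R wt₁ wt₂ ⊢R hR₁ hR₂) (comp-C wt₁ wt₂ ⊢M hM₁ hM₂)

composes : ∀ n → Composes n
composes = <-rec Composes compose-step

module _ {θ₁ θ₂ θ} (ic : IsComposition θ₂ θ₁ θ) {Γ Γ₁ Γ₂} (wt₁ : WellTyped θ₁ Γ Γ₁) (wt₂ : WellTyped θ₂ Γ₁ Γ₂) where

  private
    composes-here = composes (size θ₁ + size θ₂) {θ = θ} ≤-refl wt₁ wt₂ ic

  SubC-∘ : ∀ {M M′ M″ α} → Γ ⊢ M ∶ α → SubC θ₁ M M′ → SubC θ₂ M′ M″ → SubC θ M M″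
  SubC-∘ = proj₁ composes-here

  SubRC-∘ : ∀ {R M′ M″ α β} → Γ ⊢ R ⇒ β → SubRC θ₁ R M′ α → SubC θ₂ M′ M″ → SubRC θ R M″ α
  SubRC-∘ = proj₁ (proj₂ composes-here)

  SubR-SubRC-∘ : ∀ {R R′ M″ α β} → Γ ⊢ R ⇒ β → SubR θ₁ R R′ → SubRC θ₂ R′ M″ α → SubRC θ R M″ α
  SubR-SubRC-∘ = proj₁ (proj₂ (proj₂ composes-here))

  SubR-∘ : ∀ {R R′ R″ β} → Γ ⊢ R ⇒ β → SubR θ₁ R R′ → SubR θ₂ R′ R″ → SubR θ R R″
  SubR-∘ = proj₂ (proj₂ (proj₂ composes-here))

  SubP-∘ : ∀ {P P′ P″} → RespectsP Γ P → SubP θ₁ P P′ → SubP θ₂ P′ P″ → SubP θ P P″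
  SubP-∘ ⊢P hs-tcon hs-tcon = hs-tcon
  SubP-∘ ⊢P (hs-tapp {P = P} hP₁ hM₁) (hs-tapp hP₂ hM₂) with All-++⁻ (termsP P) ⊢P
  ... | ⊢P′ , ((_ , ⊢M) ∷ []) = hs-tapp (SubP-∘ ⊢P′ hP₁ hP₂) (SubC-∘ ⊢M hM₁ hM₂)

module _ {θ₁ θ₂ θ} (ic : IsComposition θ₂ θ₁ θ) where

  SubT-∘ : ∀ {Γ Γ₁ Γ₂ A A′ A″} → WellTyped θ₁ Γ Γ₁ → WellTyped θ₂ Γ₁ Γ₂ → RespectsT Γ A →
    SubT θ₁ A A′ → SubT θ₂ A′ A″ → SubT θ A A″
  SubT-∘ wt₁ wt₂ (rs-base ⊢P) (hs-base h₁) (hs-base h₂) = hs-base (SubP-∘ ic wt₁ wt₂ ⊢P h₁ h₂)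
  SubT-∘ wt₁ wt₂ (rs-pi {A = A} L ⊢A ⊢B) (hs-pi L₁ hA₁ hB₁) (hs-pi L₂ hA₂ hB₂) =
    hs-pi (L ++ L₁ ++ L₂ ++ supp θ₁ ++ supp θ₂) (SubT-∘ wt₁ wt₂ ⊢A hA₁ hA₂) λ x x∉ _ _ →
      let x∉L , x∉ = ∉-++⁻ L x∉
          x∉L₁ , x∉ = ∉-++⁻ L₁ x∉
          x∉L₂ , x∉ = ∉-++⁻ L₂ x∉
          x∉θ₁ , x∉θ₂ = ∉-++⁻ (supp θ₁) x∉
      in SubT-∘ (WellTyped-⟨⟩⊕ x (A ⁻) x∉θ₁ wt₁) (WellTyped-⟨⟩⊕ x (A ⁻) x∉θ₂ wt₂) (⊢B x x∉L)
           (uncurry (hB₁ x x∉L₁) (∉supp⁻ θ₁ x∉θ₁)) (uncurry (hB₂ x x∉L₂) (∉supp⁻ θ₂ x∉θ₂))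

  SubK-∘ : ∀ {Γ Γ₁ Γ₂ K K′ K″} → WellTyped θ₁ Γ Γ₁ → WellTyped θ₂ Γ₁ Γ₂ → RespectsK Γ K →
    SubK θ₁ K K′ → SubK θ₂ K′ K″ → SubK θ K K″
  SubK-∘ wt₁ wt₂ rs-type hs-type hs-type = hs-type
  SubK-∘ wt₁ wt₂ (rs-kpi {A = A} L ⊢A ⊢K) (hs-kpi L₁ hA₁ hK₁) (hs-kpi L₂ hA₂ hK₂) =
    hs-kpi (L ++ L₁ ++ L₂ ++ supp θ₁ ++ supp θ₂) (SubT-∘ wt₁ wt₂ ⊢A hA₁ hA₂) λ x x∉ _ _ →
      let x∉L , x∉ = ∉-++⁻ L x∉
          x∉L₁ , x∉ = ∉-++⁻ L₁ x∉
          x∉L₂ , x∉ = ∉-++⁻ L₂ x∉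
          x∉θ₁ , x∉θ₂ = ∉-++⁻ (supp θ₁) x∉
      in SubK-∘ (WellTyped-⟨⟩⊕ x (A ⁻) x∉θ₁ wt₁) (WellTyped-⟨⟩⊕ x (A ⁻) x∉θ₂ wt₂) (⊢K x x∉L)
           (uncurry (hK₁ x x∉L₁) (∉supp⁻ θ₁ x∉θ₁)) (uncurry (hK₂ x x∉L₂) (∉supp⁻ θ₂ x∉θ₂))

  SubCtx-∘ : ∀ {Γ Γ₁ Γ₂ E E′ E″} → WellTyped θ₁ Γ Γ₁ → WellTyped θ₂ Γ₁ Γ₂ → RespectsCtx Γ E →
    SubCtx θ₁ E E′ → SubCtx θ₂ E′ E″ → SubCtx θ E E″
  SubCtx-∘ wt₁ wt₂ rs-nil hs-nil hs-nil = hs-nil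
  SubCtx-∘ wt₁ wt₂ (rs-cons ⊢E ⊢A) (hs-cons x∉dom₁ x∉rng₁ hE₁ hA₁) (hs-cons x∉dom₂ x∉rng₂ hE₂ hA₂) =
    hs-cons (∉dom-∘ {θ₁} {θ₂} {θ} ic x∉dom₁ x∉dom₂) (∉fvRng-∘ {θ₁} {θ₂} {θ} ic x∉rng₁ x∉rng₂)
      (SubCtx-∘ wt₁ wt₂ ⊢E hE₁ hE₂) (SubT-∘ wt₁ wt₂ ⊢A hA₁ hA₂)

ArityPreserving⇒WellTyped : ∀ {Θ θ} → ArityPreserving Θ θ → WellTyped θ (ctx θ ⊕ Θ) Θ
ArityPreserving⇒WellTyped {Θ} {θ} pres = record
  { entry     = λ p → ⊕-just {ctx θ} {Θ} (svar _) (ctx-∈ₛ {θ} p) , All.lookup pres p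
  ; agree-con = λ c → refl
  ; agree-off = λ x∉ → ⊕-nothing {ctx θ} {Θ} (svar _) (ctx-∉dom {θ} x∉)
  }

Compatible⇒WellTyped₁ : ∀ {θ₁ θ₂ θ Θ} → IsComposition θ₂ θ₁ θ → Compatible θ₁ θ₂ Θ →
  WellTyped θ₁ (ctx θ ⊕ Θ) (ctx θ₂ ⊕ Θ)
Compatible⇒WellTyped₁ {θ₁} {θ₂} {θ} {Θ} ic (pres₂ , pres₁) = record
  { entry     = entry₁
  ; agree-con = λ c → refl
  ; agree-off = agree-off₁
  }
  where
  entry₁ : ∀ {x M α} → (x , M , α) ∈ₛ θ₁ → (ctx θ ⊕ Θ) (svar x) ≡ just α × (ctx θ₂ ⊕ Θ) ⊢ M ∶ α
  entry₁ {x} {M} {α} p =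
    let ⊢M = All.lookup pres₁ p
        M′ , hM , _ = SubC-exists (ArityPreserving⇒WellTyped pres₂) ⊢M
    in ⊕-just {ctx θ} {Θ} (svar x) (ctx-∈ₛ {θ} (Equivalence.from (ic x M′ α) (inj₁ (M , p , hM)))) , ⊢M
  agree-off₁ : ∀ {x} → x ∉ dom θ₁ → (ctx θ ⊕ Θ) (svar x) ≡ (ctx θ₂ ⊕ Θ) (svar x)
  agree-off₁ {x} x∉₁ with x ∈? dom θ₂
  ... | yes x∈₂ = let N , β , p = ∈dom⇒∈ₛ {θ₂} x∈₂ in
    trans (⊕-just {ctx θ} {Θ} (svar x) (ctx-∈ₛ {θ} (Equivalence.from (ic x N β) (inj₂ (p , x∉₁)))))
          (sym (⊕-just {ctx θ₂} {Θ} (svar x) (ctx-∈ₛ {θ₂} p)))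
  ... | no x∉₂ =
    trans (⊕-nothing {ctx θ} {Θ} (svar x) (ctx-∉dom {θ} (∉dom-∘ {θ₁} {θ₂} {θ} ic x∉₁ x∉₂)))
          (sym (⊕-nothing {ctx θ₂} {Θ} (svar x) (ctx-∉dom {θ₂} x∉₂)))

theorem2p10 : ∀ (θ₁ θ₂ : Subst) (Θ : ArCtx) → Compatible θ₁ θ₂ Θ →
    ∀ (θ : Subst) → IsComposition θ₂ θ₁ θ →
    -- (1) kinds
    (∀ (E E′ E″ : Kind) → RespectsK (ctx θ ⊕ Θ) E →
       SubK θ₁ E E′ → SubK θ₂ E′ E″ → SubK θ E E″)
    -- (1) types
    × (∀ (E E′ E″ : Ty) → RespectsT (ctx θ ⊕ Θ) E →
       SubT θ₁ E E′ → SubT θ₂ E′ E″ → SubT θ E E″)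
    -- (1) contexts
    × (∀ (E E′ E″ : Ctx) → RespectsCtx (ctx θ ⊕ Θ) E →
       SubCtx θ₁ E E′ → SubCtx θ₂ E′ E″ → SubCtx θ E E″)
    -- (2) canonical terms
    × (∀ (M M′ M″ : Can) (α : Arity) → (ctx θ ⊕ Θ) ⊢ M ∶ α →
       SubC θ₁ M M′ → SubC θ₂ M′ M″ → SubC θ M M″)
    -- (3a)
    × (∀ (R : Atm) (M′ M″ : Can) (α : Arity) → (ctx θ ⊕ Θ) ⊢ R ⇒ α →
       SubRC θ₁ R M′ α → SubC θ₂ M′ M″ → SubRC θ R M″ α)
    -- (3b)
    × (∀ (R R′ : Atm) (M″ : Can) (α : Arity) → (ctx θ ⊕ Θ) ⊢ R ⇒ α →
       SubR θ₁ R R′ → SubRC θ₂ R′ M″ α → SubRC θ R M″ α)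
    -- (3c)
    × (∀ (R R′ R″ : Atm) (α : Arity) → (ctx θ ⊕ Θ) ⊢ R ⇒ α →
       SubR θ₁ R R′ → SubR θ₂ R′ R″ → SubR θ R R″)
theorem2p10 θ₁ θ₂ Θ compat θ ic =
  (λ _ _ _ → SubK-∘ ic wt₁ wt₂) ,
  (λ _ _ _ → SubT-∘ ic wt₁ wt₂) ,
  (λ _ _ _ → SubCtx-∘ ic wt₁ wt₂) ,
  (λ _ _ _ _ → SubC-∘ ic wt₁ wt₂) ,
  (λ _ _ _ _ → SubRC-∘ ic wt₁ wt₂) ,
  (λ _ _ _ _ → SubR-SubRC-∘ ic wt₁ wt₂) ,
  (λ _ _ _ _ → SubR-∘ ic wt₁ wt₂)
  where
  wt₂ : WellTyped θ₂ (ctx θ₂ ⊕ Θ) Θ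
  wt₂ = ArityPreserving⇒WellTyped (proj₁ compat)
  wt₁ : WellTyped θ₁ (ctx θ ⊕ Θ) (ctx θ₂ ⊕ Θ)
  wt₁ = Compatible⇒WellTyped₁ ic compat
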